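{- Let $k$ be a positive integer and let $\mathbb{A}$ be an alphabet with exactly $k$ letters. Then there are exactly $k!$ extremal $XYX$-avoiding words over $\mathbb{A}$.
   Context: A word is a finite sequence of letters. A word $U$ is a factor of $W$ if $W=W_1UW_2$ for some (possibly empty) words $W_1,W_2$. A word realizes the pattern $XYX$ (with $X,Y$ distinct pattern variables) if it can be written as $ABA$ with $A,B$ nonempty words ($A=B$ is allowed). A word contains $XYX$ if some factor realizes it, and avoids $XYX$ otherwise. An extension of a word $W$ over $\mathbb{A}$ is any word $W_1xW_2$ with $W=W_1W_2$ ($W_1,W_2$ possibly empty) and $x\in\mathbb{A}$. A word is extremal $XYX$-avoiding if it avoids $XYX$ and every extension of it over $\mathbb{A}$ contains $XYX$. -}

module Defs where

open import Data.List using (List; []; _∷_; _++_)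
open import Data.Product using (Σ; ∃; ∃-syntax; _×_; _,_)
open import Relation.Binary.PropositionalEquality using (_≡_; _≢_)
open import Relation.Nullary using (¬_)

module _ {a} {A : Set a} where

  Factor : List A → List A → Set a
  Factor U W = ∃[ W₁ ] ∃[ W₂ ] (W ≡ W₁ ++ U ++ W₂)

  RealizesXYX : List A → Set a
  RealizesXYX W = ∃[ P ] ∃[ Q ] (P ≢ [] × Q ≢ [] × W ≡ P ++ Q ++ P)

  ContainsXYX : List A → Set a
  ContainsXYX W = ∃[ U ] (Factor U W × RealizesXYX U)

  AvoidsXYX : List A → Set a
  AvoidsXYX W = ¬ ContainsXYX W

  Extension : List A → List A → Set a
  Extension E W = ∃[ W₁ ] ∃[ W₂ ] ∃[ x ] (W ≡ W₁ ++ W₂ × E ≡ W₁ ++ x ∷ W₂)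

  ExtremalXYX : List A → Set a
  ExtremalXYX W = AvoidsXYX W × (∀ E → Extension E W → ContainsXYX E)

-- A word contains XYX exactly when some letter occurs twice with a nonempty gap,
-- so an XYX-avoiding word is a sequence of blocks x or xx of pairwise distinct
-- letters. It is extremal iff no letter can be inserted: a single x can be
-- doubled, and an absent letter can be put in front. Hence the extremal words
-- are x₁x₁x₂x₂…xₖxₖ for the k! orderings x₁…xₖ of the alphabet.
module Submission where

open import Defs
open import Data.Nat using (ℕ; _≤_; _!)
open import Data.Fin using (Fin)
open import Data.List using (List; length)
open import Data.List.Membership.Propositional using (_∈_)
open import Data.List.Relation.Unary.Unique.Propositional using (Unique)
open import Data.Product using (Σ; ∃-syntax; _×_)
open import Function.Bundles using (_⇔_)
open import Relation.Binary.PropositionalEquality using (_≡_)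

open import Level using (Level)
open import Data.Nat using (zero; suc; _+_; _*_)
open import Data.Fin using (punchIn; punchOut) renaming (_≟_ to _≟ᶠ_)
open import Data.Fin.Properties using (punchIn-injective; punchInᵢ≢i; punchIn-punchOut)
open import Data.List using ([]; _∷_; _++_; map; concatMap; allFin; drop)
open import Data.List.Properties
  using (++-assoc; ++-conicalʳ; length-++; length-map; length-tabulate; ∷-injective; ∷-injectiveʳ; map-injective)
open import Data.List.Membership.Propositional using (_∉_; find)
open import Data.List.Membership.Propositional.Properties
  using (∈-map⁺; ∈-map⁻; ∈-∃++; ∈-insert; ∈-allFin; ∈-concatMap⁺; ∈-concatMap⁻)
import Data.List.Relation.Unary.Unique.Propositional.Properties as Unique
open import Data.List.Relation.Unary.AllPairs using ([]; _∷_)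
open import Data.List.Relation.Unary.All using (All; []; _∷_)
open import Data.List.Relation.Unary.All.Properties using (All¬⇒¬Any; ¬Any⇒All¬)
open import Data.List.Relation.Unary.Any as Any using (here; there)
open import Data.Product using (_,_; proj₁)
open import Data.Unit.Polymorphic using (⊤)
open import Data.Empty using (⊥-elim)
open import Relation.Nullary using (¬_; Dec; yes; no; ¬?; _×-dec_)
open import Relation.Nullary.Decidable using (decidable-stable)
open import Relation.Binary.Definitions using (DecidableEquality)
open import Relation.Binary.PropositionalEquality using (_≢_; refl; sym; trans; cong; cong₂; subst; module ≡-Reasoning)
open import Function.Bundles using (mk⇔; Equivalence)

private
  variable
    a : Level

module _ {A : Set a} where

  IsEnumeration : List A → Set a
  IsEnumeration p = Unique p × (∀ x → x ∈ p)

  GappedRepeat : List A → Set a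
  GappedRepeat w = ∃[ u ] ∃[ x ] ∃[ v ] ∃[ t ] (v ≢ [] × w ≡ u ++ x ∷ v ++ x ∷ t)

  NoGappedRepeat : List A → Set a
  NoGappedRepeat []      = ⊤
  NoGappedRepeat (x ∷ w) = x ∉ drop 1 w × NoGappedRepeat w

  Saturated : List A → Set a
  Saturated w = ∀ W₁ W₂ y → w ≡ W₁ ++ W₂ → ¬ NoGappedRepeat (W₁ ++ y ∷ W₂)

  DoublingSaturated : List A → Set a
  DoublingSaturated w = ∀ W₁ y W₂ → w ≡ W₁ ++ y ∷ W₂ → ¬ NoGappedRepeat (W₁ ++ y ∷ y ∷ W₂)

  stutter : List A → List A
  stutter []      = []
  stutter (x ∷ p) = x ∷ x ∷ stutter p

  ∈-drop1⁻ : ∀ {y : A} w → y ∈ drop 1 w → y ∈ w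
  ∈-drop1⁻ (_ ∷ _) y∈ = there y∈

  ∈-doubled⁻ : ∀ {z y : A} W₁ {W₂} → z ∈ W₁ ++ y ∷ y ∷ W₂ → z ∈ W₁ ++ y ∷ W₂
  ∈-doubled⁻ []       (here z≡y) = here z≡y
  ∈-doubled⁻ []       (there z∈) = z∈
  ∈-doubled⁻ (_ ∷ W₁) (here z≡x) = here z≡x
  ∈-doubled⁻ (_ ∷ W₁) (there z∈) = there (∈-doubled⁻ W₁ z∈)

  ∈-stutter⁺ : ∀ {y : A} p → y ∈ p → y ∈ stutter p
  ∈-stutter⁺ (_ ∷ p) (here y≡x) = here y≡x
  ∈-stutter⁺ (_ ∷ p) (there y∈) = there (there (∈-stutter⁺ p y∈))

  ∈-stutter⁻ : ∀ {y : A} p → y ∈ stutter p → y ∈ p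
  ∈-stutter⁻ (_ ∷ p) (here y≡x)         = here y≡x
  ∈-stutter⁻ (_ ∷ p) (there (here y≡x)) = here y≡x
  ∈-stutter⁻ (_ ∷ p) (there (there y∈)) = there (∈-stutter⁻ p y∈)

  stutter-injective : ∀ p q → stutter p ≡ stutter q → p ≡ q
  stutter-injective []      []      _  = refl
  stutter-injective (x ∷ p) (y ∷ q) eq with ∷-injective eq
  ... | refl , eq′ = cong (x ∷_) (stutter-injective p q (∷-injectiveʳ eq′))

  gappedRepeat⇒containsXYX : ∀ {w} → GappedRepeat w → ContainsXYX w
  gappedRepeat⇒containsXYX (u , x , v , t , v≢[] , refl) =
    x ∷ v ++ x ∷ [] , (u , t , cong (λ s → u ++ x ∷ s) (sym (++-assoc v (x ∷ []) t)))
                    , x ∷ [] , v , (λ ()) , v≢[] , refl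

  containsXYX⇒gappedRepeat : ∀ {w} → ContainsXYX w → GappedRepeat w
  containsXYX⇒gappedRepeat (_ , _ , [] , _ , P≢[] , _ , _) = ⊥-elim (P≢[] refl)
  containsXYX⇒gappedRepeat (_ , (W₁ , W₂ , refl) , x ∷ P , Q , _ , Q≢[] , refl) =
    W₁ , x , P ++ Q , P ++ W₂ , (λ PQ≡[] → Q≢[] (++-conicalʳ P Q PQ≡[])) ,
    cong (λ s → W₁ ++ x ∷ s) regroup
    where
    open ≡-Reasoning
    regroup : (P ++ Q ++ x ∷ P) ++ W₂ ≡ (P ++ Q) ++ x ∷ P ++ W₂
    regroup = begin
      (P ++ Q ++ x ∷ P) ++ W₂   ≡⟨ ++-assoc P (Q ++ x ∷ P) W₂ ⟩
      P ++ (Q ++ x ∷ P) ++ W₂   ≡⟨ cong (P ++_) (++-assoc Q (x ∷ P) W₂) ⟩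
      P ++ Q ++ x ∷ P ++ W₂     ≡⟨ ++-assoc P Q (x ∷ P ++ W₂) ⟨
      (P ++ Q) ++ x ∷ P ++ W₂   ∎

  noGappedRepeat⇒¬gappedRepeat : ∀ {w} → NoGappedRepeat w → ¬ GappedRepeat w
  noGappedRepeat⇒¬gappedRepeat ngr (u , x , v , t , v≢[] , refl) = go u v v≢[] ngr
    where
    go : ∀ u v → v ≢ [] → ¬ NoGappedRepeat (u ++ x ∷ v ++ x ∷ t)
    go []      []      v≢[] _        = v≢[] refl
    go []      (_ ∷ v) _    (x∉ , _) = x∉ (∈-insert v)
    go (_ ∷ u) v       v≢[] (_ , ngr′) = go u v v≢[] ngr′

  noGappedRepeat-stutter : ∀ p → Unique p → NoGappedRepeat (stutter p)
  noGappedRepeat-stutter []      _            = _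
  noGappedRepeat-stutter (x ∷ p) (x∉p ∷ uniq) =
    x∉ , (λ x∈ → x∉ (∈-drop1⁻ (stutter p) x∈)) , noGappedRepeat-stutter p uniq
    where
    x∉ : x ∉ stutter p
    x∉ x∈ = All¬⇒¬Any x∉p (∈-stutter⁻ p x∈)

  noGappedRepeat-stutter⁻ : ∀ p → NoGappedRepeat (stutter p) → Unique p
  noGappedRepeat-stutter⁻ []      _              = []
  noGappedRepeat-stutter⁻ (x ∷ p) (x∉ , _ , ngr) =
    ¬Any⇒All¬ p (λ x∈ → x∉ (∈-stutter⁺ p x∈)) ∷ noGappedRepeat-stutter⁻ p ngr

  -- A letter of p inserted into stutter p is a third occurrence of it.
  stutter-insert : ∀ p {y : A} W₁ W₂ → y ∈ p → stutter p ≡ W₁ ++ W₂ →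
                   ¬ NoGappedRepeat (W₁ ++ y ∷ W₂)
  stutter-insert (x ∷ p) [] _ y∈ refl (y∉ , _) with y∈
  ... | here y≡x = y∉ (here y≡x)
  ... | there y∈p = y∉ (there (∈-stutter⁺ p y∈p))
  stutter-insert (x ∷ p) (_ ∷ []) _ _ refl (x∉ , _) = x∉ (here refl)
  stutter-insert (x ∷ p) (_ ∷ _ ∷ W₁) W₂ y∈ eq (x∉ , _ , ngr) with ∷-injective eq
  ... | refl , eq′ with ∷-injective eq′
  ... | refl , eq″ with y∈
  ... | here refl = x∉ (∈-insert W₁)
  ... | there y∈p = stutter-insert p W₁ W₂ y∈p eq″ ngr

  stutter-saturated : ∀ p → (∀ x → x ∈ p) → Saturated (stutter p)
  stutter-saturated p complete W₁ W₂ y = stutter-insert p W₁ W₂ (complete y)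

  saturated⇒doublingSaturated : ∀ {w} → Saturated w → DoublingSaturated w
  saturated⇒doublingSaturated sat W₁ y W₂ = sat W₁ (y ∷ W₂) y

module _ {A : Set a} (_≟_ : DecidableEquality A) where

  open import Data.List.Membership.DecPropositional _≟_ using (_∈?_)

  -- A lone x is refuted by doubling it; after a block x ∷ x the hypothesis passes
  -- to r, since doubling a letter of r never creates a second occurrence of x ∉ r.
  doublingSaturated⇒stutter : ∀ w → NoGappedRepeat w → DoublingSaturated w →
                              ∃[ p ] w ≡ stutter p
  doublingSaturated⇒stutter []          _   _   = [] , refl
  doublingSaturated⇒stutter (x ∷ [])    _   sat = ⊥-elim (sat [] x [] refl ((λ ()) , (λ ()) , _))
  doublingSaturated⇒stutter (x ∷ z ∷ r) ngr sat with x ≟ z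
  ... | no x≢z = ⊥-elim (sat [] x (z ∷ r) refl (x∉zr , ngr))
    where
    x∉zr : x ∉ z ∷ r
    x∉zr (here x≡z) = x≢z x≡z
    x∉zr (there x∈) = proj₁ ngr x∈
  ... | yes refl with ngr
  ... | x∉r , _ , ngr′ with doublingSaturated⇒stutter r ngr′ sat′
    where
    sat′ : DoublingSaturated r
    sat′ W₁ y W₂ refl ngr″ =
      sat (x ∷ x ∷ W₁) y W₂ refl (x∉ , (λ x∈ → x∉ (∈-drop1⁻ (W₁ ++ y ∷ y ∷ W₂) x∈)) , ngr″)
      where
      x∉ : x ∉ W₁ ++ y ∷ y ∷ W₂
      x∉ x∈ = x∉r (∈-doubled⁻ W₁ x∈)
  ... | p , refl = x ∷ p , refl

  noGappedRepeat? : ∀ w → Dec (NoGappedRepeat w)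
  noGappedRepeat? []      = yes _
  noGappedRepeat? (x ∷ w) = ¬? (x ∈? drop 1 w) ×-dec noGappedRepeat? w

  ¬noGappedRepeat⇒gappedRepeat : ∀ w → ¬ NoGappedRepeat w → GappedRepeat w
  ¬noGappedRepeat⇒gappedRepeat []      ¬ngr = ⊥-elim (¬ngr _)
  ¬noGappedRepeat⇒gappedRepeat (x ∷ w) ¬ngr with x ∈? drop 1 w
  ¬noGappedRepeat⇒gappedRepeat (x ∷ y ∷ _) _ | yes x∈ with ∈-∃++ x∈
  ... | v , t , refl = [] , x , y ∷ v , t , (λ ()) , refl
  ¬noGappedRepeat⇒gappedRepeat (x ∷ w) ¬ngr | no x∉
    with ¬noGappedRepeat⇒gappedRepeat w (λ ngr → ¬ngr (x∉ , ngr))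
  ... | u , y , v , t , v≢[] , eq = x ∷ u , y , v , t , v≢[] , cong (x ∷_) eq

  avoidsXYX⇒noGappedRepeat : ∀ w → AvoidsXYX w → NoGappedRepeat w
  avoidsXYX⇒noGappedRepeat w avoids with noGappedRepeat? w
  ... | yes ngr = ngr
  ... | no ¬ngr = ⊥-elim (avoids (gappedRepeat⇒containsXYX (¬noGappedRepeat⇒gappedRepeat w ¬ngr)))

  extremalXYX⇔saturated : ∀ w → ExtremalXYX w ⇔ (NoGappedRepeat w × Saturated w)
  extremalXYX⇔saturated w = mk⇔
    (λ (avoids , extended) →
      avoidsXYX⇒noGappedRepeat w avoids ,
      λ W₁ W₂ y eq ngr → noGappedRepeat⇒¬gappedRepeat ngr
        (containsXYX⇒gappedRepeat (extended _ (W₁ , W₂ , y , eq , refl))))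
    (λ (ngr , sat) →
      (λ contains → noGappedRepeat⇒¬gappedRepeat ngr (containsXYX⇒gappedRepeat contains)) ,
      λ { _ (W₁ , W₂ , y , eq , refl) →
          gappedRepeat⇒containsXYX (¬noGappedRepeat⇒gappedRepeat _ (sat W₁ W₂ y eq)) })

  saturated⇒complete : ∀ {w} → NoGappedRepeat w → Saturated w → ∀ y → y ∈ w
  saturated⇒complete {w} ngr sat y = decidable-stable (y ∈? w)
    λ y∉ → sat [] w y refl ((λ y∈ → y∉ (∈-drop1⁻ w y∈)) , ngr)

  extremalXYX⇔stutter : ∀ w → ExtremalXYX w ⇔ (∃[ p ] (IsEnumeration p × w ≡ stutter p))
  extremalXYX⇔stutter w = mk⇔ to from
    where
    to : ExtremalXYX w → ∃[ p ] (IsEnumeration p × w ≡ stutter p)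
    to extremal with ngr , sat ← Equivalence.to (extremalXYX⇔saturated w) extremal
                with p , refl ← doublingSaturated⇒stutter w ngr (saturated⇒doublingSaturated sat)
      = p , (noGappedRepeat-stutter⁻ p ngr , λ y → ∈-stutter⁻ p (saturated⇒complete ngr sat y)) , refl
    from : ∃[ p ] (IsEnumeration p × w ≡ stutter p) → ExtremalXYX w
    from (p , (unique , complete) , refl) = Equivalence.from (extremalXYX⇔saturated w)
      (noGappedRepeat-stutter p unique , stutter-saturated p complete)

module _ {A : Set a} where

  branches : (A → List (List A)) → List A → List (List A)
  branches f = concatMap (λ i → map (i ∷_) (f i))

  length-branches : ∀ f c l → (∀ i → length (f i) ≡ c) → length (branches f l) ≡ length l * c
  length-branches f c []      _       = refl
  length-branches f c (i ∷ l) lengths = begin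
    length (map (i ∷_) (f i) ++ branches f l)         ≡⟨ length-++ (map (i ∷_) (f i)) ⟩
    length (map (i ∷_) (f i)) + length (branches f l) ≡⟨ cong₂ _+_ length-head (length-branches f c l lengths) ⟩
    c + length l * c                                  ∎
    where
    open ≡-Reasoning
    length-head : length (map (i ∷_) (f i)) ≡ c
    length-head = trans (length-map (i ∷_) (f i)) (lengths i)

  ∈-branches⁺ : ∀ f {l i p} → i ∈ l → p ∈ f i → i ∷ p ∈ branches f l
  ∈-branches⁺ f {l} i∈ p∈ =
    ∈-concatMap⁺ (λ i → map (i ∷_) (f i)) {xs = l} (Any.map (λ { refl → ∈-map⁺ (_ ∷_) p∈ }) i∈)

  ∈-branches⁻ : ∀ f l {q} → q ∈ branches f l → ∃[ i ] ∃[ p ] (i ∈ l × p ∈ f i × q ≡ i ∷ p)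
  ∈-branches⁻ f l q∈
    with i , i∈ , q∈fi ← find (∈-concatMap⁻ (λ i → map (i ∷_) (f i)) {xs = l} q∈)
    with p , p∈ , refl ← ∈-map⁻ (i ∷_) q∈fi
    = i , p , i∈ , p∈ , refl

  branches-unique : ∀ f {l} → Unique l → (∀ i → Unique (f i)) → Unique (branches f l)
  branches-unique f {[]}    _              _       = []
  branches-unique f {i ∷ l} (i∉l ∷ unique) uniques =
    Unique.++⁺ (Unique.map⁺ ∷-injectiveʳ (uniques i)) (branches-unique f unique uniques) disjoint
    where
    disjoint : ∀ {q} → ¬ (q ∈ map (i ∷_) (f i) × q ∈ branches f l)
    disjoint (q∈i , q∈l) with _ , _ , refl ← ∈-map⁻ (i ∷_) q∈i
                         with j , _ , j∈ , _ , refl ← ∈-branches⁻ f l q∈l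
      = All¬⇒¬Any i∉l j∈

punchInAll : ∀ {n} → List (List (Fin n)) → Fin (suc n) → List (List (Fin (suc n)))
punchInAll ps i = map (map (punchIn i)) ps

enumerations : (n : ℕ) → List (List (Fin n))
enumerations zero    = [] ∷ []
enumerations (suc n) = branches (punchInAll (enumerations n)) (allFin (suc n))

length-enumerations : ∀ n → length (enumerations n) ≡ n !
length-enumerations zero    = refl
length-enumerations (suc n) = begin
  length (enumerations (suc n)) ≡⟨ length-branches (punchInAll (enumerations n)) (n !) (allFin (suc n)) length-punchInAll ⟩
  length (allFin (suc n)) * n ! ≡⟨ cong (_* n !) (length-tabulate {n = suc n} (λ i → i)) ⟩
  suc n * n !                   ∎
  where
  open ≡-Reasoning
  length-punchInAll : ∀ i → length (punchInAll (enumerations n) i) ≡ n !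
  length-punchInAll i = trans (length-map (map (punchIn i)) (enumerations n)) (length-enumerations n)

enumerations-unique : ∀ n → Unique (enumerations n)
enumerations-unique zero    = [] ∷ []
enumerations-unique (suc n) =
  branches-unique (punchInAll (enumerations n)) (Unique.allFin⁺ (suc n)) λ i →
    Unique.map⁺ (map-injective (punchIn-injective i _ _)) (enumerations-unique n)

map-punchIn-onto : ∀ {n} (i : Fin (suc n)) {q} → All (i ≢_) q → ∃[ p ] map (punchIn i) p ≡ q
map-punchIn-onto i []            = [] , refl
map-punchIn-onto i (i≢j ∷ i≢q) with p , refl ← map-punchIn-onto i i≢q =
  punchOut i≢j ∷ p , cong (_∷ map (punchIn i) p) (punchIn-punchOut i≢j)

module _ {n} (i : Fin (suc n)) (p : List (Fin n)) where

  isEnumeration-punchIn⁺ : IsEnumeration p → IsEnumeration (i ∷ map (punchIn i) p)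
  isEnumeration-punchIn⁺ (unique , complete) =
    ¬Any⇒All¬ _ i∉ ∷ Unique.map⁺ (punchIn-injective i _ _) unique , complete′
    where
    i∉ : i ∉ map (punchIn i) p
    i∉ i∈ with j , _ , i≡ ← ∈-map⁻ (punchIn i) i∈ = punchInᵢ≢i i j (sym i≡)
    complete′ : ∀ j → j ∈ i ∷ map (punchIn i) p
    complete′ j with i ≟ᶠ j
    ... | yes i≡j = here (sym i≡j)
    ... | no i≢j  = there (subst (_∈ map (punchIn i) p) (punchIn-punchOut i≢j)
                                 (∈-map⁺ (punchIn i) (complete (punchOut i≢j))))

  isEnumeration-punchIn⁻ : IsEnumeration (i ∷ map (punchIn i) p) → IsEnumeration p
  isEnumeration-punchIn⁻ (_ ∷ unique , complete) = Unique.map⁻ unique , complete′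
    where
    complete′ : ∀ j → j ∈ p
    complete′ j with complete (punchIn i j)
    ... | here ↑j≡i = ⊥-elim (punchInᵢ≢i i j ↑j≡i)
    ... | there ↑j∈ with k , k∈ , ↑j≡↑k ← ∈-map⁻ (punchIn i) ↑j∈ =
      subst (_∈ p) (sym (punchIn-injective i j k ↑j≡↑k)) k∈

∈-enumerations⁻ : ∀ n {q} → q ∈ enumerations n → IsEnumeration q
∈-enumerations⁻ zero    (here refl) = [] , λ ()
∈-enumerations⁻ (suc n) q∈
  with i , _ , _ , p∈ , refl ← ∈-branches⁻ (punchInAll (enumerations n)) (allFin (suc n)) q∈
  with p , p∈ , refl ← ∈-map⁻ (map (punchIn i)) p∈ =
  isEnumeration-punchIn⁺ i p (∈-enumerations⁻ n p∈)

∈-enumerations⁺ : ∀ n {q} → IsEnumeration q → q ∈ enumerations n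
∈-enumerations⁺ zero    {[]}    _ = here refl
∈-enumerations⁺ zero    {() ∷ _}
∈-enumerations⁺ (suc n) {[]}    (_ , complete) with () ← complete Data.Fin.zero
∈-enumerations⁺ (suc n) {i ∷ q} enumeration@(i∉q ∷ _ , _)
  with p , refl ← map-punchIn-onto i i∉q =
  ∈-branches⁺ (punchInAll (enumerations n)) (∈-allFin i)
    (∈-map⁺ (map (punchIn i)) (∈-enumerations⁺ n (isEnumeration-punchIn⁻ i p enumeration)))

lemma2p2 : (k : ℕ) → 1 ≤ k →
    ∃[ ws ] (Unique ws × length ws ≡ k ! ×
      (∀ (w : List (Fin k)) → (w ∈ ws) ⇔ ExtremalXYX w))
lemma2p2 k _ =
  map stutter (enumerations k) ,
  Unique.map⁺ (stutter-injective _ _) (enumerations-unique k) ,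
  trans (length-map stutter (enumerations k)) (length-enumerations k) ,
  λ w → mk⇔ (listed⇒extremal w) (extremal⇒listed w)
  where
  listed⇒extremal : ∀ w → w ∈ map stutter (enumerations k) → ExtremalXYX w
  listed⇒extremal w w∈ with p , p∈ , w≡ ← ∈-map⁻ stutter w∈ =
    Equivalence.from (extremalXYX⇔stutter _≟ᶠ_ w) (p , ∈-enumerations⁻ k p∈ , w≡)
  extremal⇒listed : ∀ w → ExtremalXYX w → w ∈ map stutter (enumerations k)
  extremal⇒listed w extremal
    with p , enumeration , refl ← Equivalence.to (extremalXYX⇔stutter _≟ᶠ_ w) extremal =
    ∈-map⁺ stutter (∈-enumerations⁺ k enumeration)
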